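{- Let $R \cong R_1 \times R_2$, where $R_1, R_2$ are local commutative rings with unity with maximal ideals $\mathcal{M}_1, \mathcal{M}_2$. Then $\mathrm{PIS}(R)$ is a split graph if and only if $R$ is isomorphic either to $F_1 \times F_2$ for fields $F_1, F_2$, or to $F_1 \times R_2$ where $F_1$ is a field and $R_2$ is a local ring whose only nonzero proper ideal is its maximal ideal $\mathcal{M}_2$ (i.e. $\mathcal{I}^*(R_2) = \{\mathcal{M}_2\}$).
   Context: For a commutative ring $R$ with unity, $\mathcal{I}^*(R)$ denotes the set of nonzero proper ideals of $R$. The prime ideal sum graph $\mathrm{PIS}(R)$ is the simple undirected graph with vertex set $\mathcal{I}^*(R)$, two distinct vertices $I, J$ adjacent if and only if $I+J$ is a prime ideal of $R$. A graph is a split graph if its vertex set is a disjoint union $A \cup B$ where $A$ induces a complete subgraph and $B$ is an independent set. -}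

module Defs where

open import Level using (Level; _⊔_) renaming (suc to lsuc)
open import Algebra.Bundles using (CommutativeRing)
open import Algebra.Morphism.Structures using (IsRingIsomorphism)
open import Algebra.Construct.DirectProduct using () renaming (commutativeRing to _×ʳ_)
open import Data.Product using (Σ; ∃; _×_; _,_; proj₁)
open import Data.Sum using (_⊎_)
open import Relation.Nullary using (¬_)
open import Data.Empty using (⊥)

private variable c ℓ c′ ℓ′ : Level

_≅_ : CommutativeRing c ℓ → CommutativeRing c′ ℓ′ → Set (c ⊔ ℓ ⊔ c′ ⊔ ℓ′)
R ≅ S = Σ (CommutativeRing.Carrier R → CommutativeRing.Carrier S)
          (IsRingIsomorphism (CommutativeRing.rawRing R) (CommutativeRing.rawRing S))

_⊗_ : CommutativeRing c ℓ → CommutativeRing c′ ℓ′ → CommutativeRing (c ⊔ c′) (ℓ ⊔ ℓ′)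
R ⊗ S = R ×ʳ S

module _ (R : CommutativeRing c ℓ) where
  open CommutativeRing R

  record Ideal : Set (lsuc (c ⊔ ℓ)) where
    field
      mem      : Carrier → Set (c ⊔ ℓ)
      resp     : ∀ {x y} → x ≈ y → mem x → mem y
      0∈       : mem 0#
      +-closed : ∀ {x y} → mem x → mem y → mem (x + y)
      neg-closed : ∀ {x} → mem x → mem (- x)
      *-closed : ∀ r {x} → mem x → mem (r * x)
  open Ideal public

  _≐_ : Ideal → Ideal → Set (c ⊔ ℓ)
  I ≐ J = ∀ x → (mem I x → mem J x) × (mem J x → mem I x)

  _⊆ᴵ_ : Ideal → Ideal → Set (c ⊔ ℓ)
  I ⊆ᴵ J = ∀ x → mem I x → mem J x

  IsNonzero : Ideal → Set (c ⊔ ℓ)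
  IsNonzero I = ¬ (∀ x → mem I x → x ≈ 0#)

  IsProper : Ideal → Set (c ⊔ ℓ)
  IsProper I = ¬ mem I 1#

  IsPrime : Ideal → Set (c ⊔ ℓ)
  IsPrime I = IsProper I × (∀ a b → mem I (a * b) → mem I a ⊎ mem I b)

  IsMaximal : Ideal → Set (lsuc (c ⊔ ℓ))
  IsMaximal M = IsProper M × (∀ J → M ⊆ᴵ J → (J ≐ M) ⊎ mem J 1#)

  _⊕_ : Ideal → Ideal → Ideal
  I ⊕ J = record
    { mem = λ x → Σ Carrier λ a → Σ Carrier λ b → mem I a × mem J b × (x ≈ a + b)
    ; resp = λ { x≈y (a , b , a∈ , b∈ , e) → a , b , a∈ , b∈ , trans (sym x≈y) e }
    ; 0∈ = 0# , 0# , 0∈ I , 0∈ J , sym (+-identityʳ 0#)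
    ; +-closed = λ { (a , b , a∈ , b∈ , e) (a′ , b′ , a′∈ , b′∈ , e′) →
        a + a′ , b + b′ , +-closed I a∈ a′∈ , +-closed J b∈ b′∈ ,
        trans (+-cong e e′) (+-middle a b a′ b′) }
    ; neg-closed = λ { (a , b , a∈ , b∈ , e) →
        - a , - b , neg-closed I a∈ , neg-closed J b∈ ,
        trans (-‿cong e) (neg-distrib a b) }
    ; *-closed = λ r → λ { (a , b , a∈ , b∈ , e) →
        r * a , r * b , *-closed I r a∈ , *-closed J r b∈ ,
        trans (*-cong refl e) (distribˡ r a b) }
    }
    where
    open import Algebra.Properties.CommutativeSemigroup +-commutativeSemigroup
      using () renaming (interchange to +-middle)
    open import Algebra.Properties.AbelianGroup +-abelianGroup
      using () renaming (⁻¹-∙-comm to neg-distrib′)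
    neg-distrib : ∀ a b → - (a + b) ≈ - a + - b
    neg-distrib a b = sym (neg-distrib′ a b)

  IsLocal : Set (lsuc (c ⊔ ℓ))
  IsLocal = Σ Ideal λ M → IsMaximal M × (∀ N → IsMaximal N → N ≐ M)

  IsUniqueMaximal : Ideal → Set (lsuc (c ⊔ ℓ))
  IsUniqueMaximal M = IsMaximal M × (∀ N → IsMaximal N → N ≐ M)

  IsField : Set (c ⊔ ℓ)
  IsField = ¬ (1# ≈ 0#) × (∀ x → ¬ (x ≈ 0#) → Σ Carrier λ y → x * y ≈ 1#)

  Vertex : Set (lsuc (c ⊔ ℓ))
  Vertex = Σ Ideal λ I → IsNonzero I × IsProper I

  PIS-Adj : Vertex → Vertex → Set (c ⊔ ℓ)
  PIS-Adj (I , _) (J , _) = ¬ (I ≐ J) × IsPrime (I ⊕ J)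

IsSplitGraph : ∀ {v e q} (V : Set v) (_~_ : V → V → Set q) (E : V → V → Set e)
               (k : Level) → Set (v ⊔ e ⊔ q ⊔ lsuc k)
IsSplitGraph V _~_ E k =
  Σ (V → Set k) λ A → Σ (V → Set k) λ B →
    (∀ x → A x ⊎ B x) ×
    (∀ x → A x → B x → ⊥) ×
    (∀ x y → A x → A y → ¬ (x ~ y) → E x y) ×
    (∀ x y → B x → B y → ¬ E x y)

PIS-IsSplit : CommutativeRing c ℓ → Set (lsuc (c ⊔ ℓ))
PIS-IsSplit {c} {ℓ} R =
  IsSplitGraph (Vertex R) (λ u v → _≐_ R (proj₁ u) (proj₁ v)) (PIS-Adj R) (c ⊔ ℓ)

{-# OPTIONS --safe #-}
module Submission where

open import Defs
open import Level using (Level; _⊔_; Lift; lift; lower) renaming (suc to lsuc)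
open import Algebra.Bundles using (CommutativeRing)
open import Axiom.ExcludedMiddle using (ExcludedMiddle)
open import Data.Product using (Σ; _×_; _,_; proj₁; proj₂; swap)
open import Data.Sum using (_⊎_; inj₁; inj₂; [_,_]′) renaming (map to ⊎-map; swap to ⊎-swap)
open import Data.Empty using (⊥; ⊥-elim)
open import Data.Unit using (⊤; tt)
open import Relation.Nullary using (¬_; Dec; yes; no)
open import Relation.Nullary.Decidable using (map′; decidable-stable; toSum)
open import Function.Base using (_∘_)
import Algebra.Properties.Ring as RingProperties
open import Algebra.Morphism.Structures using (IsRingIsomorphism)
import Algebra.Morphism.Construct.Composition as Composition
open import Function.Bundles using (_⇔_; mk⇔)

-- Transport R to P × Q and use the idempotents e₁ = (1,0), e₂ = (0,1): since e₁e₂ = 0 every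
-- prime ideal contains e₁ or e₂, and an ideal containing both is the whole ring. If neither
-- factor is a field, P×0 ⊂ P×M₂ and 0×Q ⊂ M₁×Q span an induced 2K₂. If P is a field and
-- 0 ≠ X ⊊ M in Q, the ideals 0×X, 0×M, 0×Q, P×M span an induced C₄; so M is a minimal ideal,
-- hence the only nonzero proper one. Neither configuration can occur in a split graph.
-- Conversely, every ideal of P × Q is the product of its two slices, which pins down the
-- vertices: for two fields they are P×0 and 0×Q, an independent set; for P × S they are the
-- clique 0×M, P×0, P×M (any two of them sum to the prime P×M) and the single vertex 0×S.

module IdealLemmas {c ℓ : Level} (T : CommutativeRing c ℓ) where
  open CommutativeRing T
  open RingProperties ring using (-0#≈0#; -‿distribˡ-*)
  open import Relation.Binary.Reasoning.Setoid setoid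

  infix 4 _⊆_ _≋_
  infixl 6 _+ᴵ_

  _+ᴵ_ : Ideal T → Ideal T → Ideal T
  _+ᴵ_ = _⊕_ T

  _⊆_ : Ideal T → Ideal T → Set (c ⊔ ℓ)
  _⊆_ = _⊆ᴵ_ T

  _≋_ : Ideal T → Ideal T → Set (c ⊔ ℓ)
  _≋_ = _≐_ T

  IsZero : Ideal T → Set (c ⊔ ℓ)
  IsZero I = ∀ x → mem I x → x ≈ 0#

  ⊤ᴵ : Ideal T
  ⊤ᴵ = record
    { mem = λ _ → Lift (c ⊔ ℓ) ⊤ ; resp = λ _ _ → lift tt ; 0∈ = lift tt
    ; +-closed = λ _ _ → lift tt ; neg-closed = λ _ → lift tt ; *-closed = λ _ _ → lift tt }

  0ᴵ : Ideal T
  0ᴵ = record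
    { mem = λ x → Lift c (x ≈ 0#)
    ; resp = λ { x≈y (lift x≈0) → lift (trans (sym x≈y) x≈0) }
    ; 0∈ = lift refl
    ; +-closed = λ { (lift x≈0) (lift y≈0) → lift (trans (+-cong x≈0 y≈0) (+-identityʳ 0#)) }
    ; neg-closed = λ { (lift x≈0) → lift (trans (-‿cong x≈0) -0#≈0#) }
    ; *-closed = λ { r (lift x≈0) → lift (trans (*-cong refl x≈0) (zeroʳ r)) }
    }

  ⟨_⟩ : Carrier → Ideal T
  ⟨ a ⟩ = record
    { mem = λ x → Σ Carrier λ r → x ≈ r * a
    ; resp = λ { x≈y (r , x≈ra) → r , trans (sym x≈y) x≈ra }
    ; 0∈ = 0# , sym (zeroˡ a)
    ; +-closed = λ { (r , p) (s , q) → r + s , trans (+-cong p q) (sym (distribʳ a r s)) }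
    ; neg-closed = λ { (r , p) → - r , trans (-‿cong p) (-‿distribˡ-* r a) }
    ; *-closed = λ { t (r , p) → t * r , trans (*-cong refl p) (sym (*-assoc t r a)) }
    }

  a∈⟨a⟩ : ∀ a → mem ⟨ a ⟩ a
  a∈⟨a⟩ a = 1# , sym (*-identityˡ a)

  ⟨⟩-least : ∀ {I : Ideal T} {a : Carrier} → mem I a → ⟨ a ⟩ ⊆ I
  ⟨⟩-least {I} a∈I x (r , x≈ra) = resp I (sym x≈ra) (*-closed I r a∈I)

  0ᴵ-least : ∀ {I : Ideal T} → 0ᴵ ⊆ I
  0ᴵ-least {I} x (lift x≈0) = resp I (sym x≈0) (0∈ I)

  ⊆-⊤ᴵ : ∀ {I : Ideal T} → I ⊆ ⊤ᴵ
  ⊆-⊤ᴵ _ _ = lift tt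

  ≋-sym : ∀ {I J : Ideal T} → I ≋ J → J ≋ I
  ≋-sym I≋J x = proj₂ (I≋J x) , proj₁ (I≋J x)

  ≋-trans : ∀ {I J K : Ideal T} → I ≋ J → J ≋ K → I ≋ K
  ≋-trans I≋J J≋K x = (λ x∈I → proj₁ (J≋K x) (proj₁ (I≋J x) x∈I))
                    , (λ x∈K → proj₂ (I≋J x) (proj₂ (J≋K x) x∈K))

  IsNonzero⇒≉0ᴵ : ∀ {I : Ideal T} → IsNonzero T I → ¬ 0ᴵ ≋ I
  IsNonzero⇒≉0ᴵ nonzero 0ᴵ≋I = nonzero λ x x∈I → lower (proj₂ (0ᴵ≋I x) x∈I)

  1∈⇒∈ : ∀ {I : Ideal T} → mem I 1# → ∀ x → mem I x
  1∈⇒∈ {I} 1∈I x = resp I (*-identityʳ x) (*-closed I x 1∈I)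

  IsZero⇒≋ : ∀ {I J : Ideal T} → IsZero I → IsZero J → I ≋ J
  IsZero⇒≋ {I} {J} zI zJ x =
    (λ x∈I → resp J (sym (zI x x∈I)) (0∈ J)) , (λ x∈J → resp I (sym (zJ x x∈J)) (0∈ I))

  1∈⇒≋ : ∀ {I J : Ideal T} → mem I 1# → mem J 1# → I ≋ J
  1∈⇒≋ {I} {J} 1∈I 1∈J x = (λ _ → 1∈⇒∈ {J} 1∈J x) , (λ _ → 1∈⇒∈ {I} 1∈I x)

  IsPrime-resp : ∀ {I J : Ideal T} → I ≋ J → IsPrime T I → IsPrime T J
  IsPrime-resp {I} {J} I≋J (proper , prime) =
    (λ 1∈J → proper (proj₂ (I≋J 1#) 1∈J)) ,
    λ a b ab∈J → ⊎-map (proj₁ (I≋J a)) (proj₁ (I≋J b)) (prime a b (proj₂ (I≋J _) ab∈J))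

  ⊆-+ᴵˡ : ∀ {I J : Ideal T} → I ⊆ I +ᴵ J
  ⊆-+ᴵˡ {I} {J} x x∈I = x , 0# , x∈I , 0∈ J , sym (+-identityʳ x)

  ⊆-+ᴵʳ : ∀ {I J : Ideal T} → J ⊆ I +ᴵ J
  ⊆-+ᴵʳ {I} {J} x x∈J = 0# , x , 0∈ I , x∈J , sym (+-identityˡ x)

  +ᴵ-least : ∀ {I J W : Ideal T} → I ⊆ W → J ⊆ W → I +ᴵ J ⊆ W
  +ᴵ-least {W = W} I⊆W J⊆W x (a , b , a∈I , b∈J , x≈a+b) =
    resp W (sym x≈a+b) (+-closed W (I⊆W a a∈I) (J⊆W b b∈J))

  ⊆⇒IsPrime-+ᴵ : ∀ {I J : Ideal T} → I ⊆ J → IsPrime T J → IsPrime T (I +ᴵ J)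
  ⊆⇒IsPrime-+ᴵ {I} {J} I⊆J =
    IsPrime-resp {J} {I +ᴵ J} (λ x → ⊆-+ᴵʳ {I} {J} x , +ᴵ-least {I} {J} {J} I⊆J (λ _ y → y) x)

  ⊆⇒PIS-Adj : ∀ {x y : Vertex T} → proj₁ x ⊆ proj₁ y → IsPrime T (proj₁ y) → ¬ proj₁ x ≋ proj₁ y →
              PIS-Adj T x y
  ⊆⇒PIS-Adj {I , _} {J , _} I⊆J prime I≉J = I≉J , ⊆⇒IsPrime-+ᴵ {I} {J} I⊆J prime

  1≈+⇒¬PIS-Adj : ∀ {x y : Vertex T} {a b : Carrier} → mem (proj₁ x) a → mem (proj₁ y) b → a + b ≈ 1# →
                 ¬ PIS-Adj T x y
  1≈+⇒¬PIS-Adj {I , _} {J , _} {a} {b} a∈I b∈J a+b≈1 (_ , proper , _) = proper (a , b , a∈I , b∈J , sym a+b≈1)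

  ∈∉⇒≉ : ∀ {I J : Ideal T} {z : Carrier} → mem I z → ¬ mem J z → ¬ I ≋ J
  ∈∉⇒≉ {z = z} z∈I z∉J I≋J = z∉J (proj₁ (I≋J z) z∈I)

  ∉∈⇒≉ : ∀ {I J : Ideal T} {z : Carrier} → ¬ mem I z → mem J z → ¬ I ≋ J
  ∉∈⇒≉ {z = z} z∉I z∈J I≋J = z∉I (proj₂ (I≋J z) z∈J)

  ∈⇒IsNonzero : ∀ {I : Ideal T} {z : Carrier} → mem I z → ¬ z ≈ 0# → IsNonzero T I
  ∈⇒IsNonzero {z = z} z∈I z≉0 zero = z≉0 (zero z z∈I)

  IsProper⇒1≉0 : ∀ {I : Ideal T} → IsProper T I → ¬ 1# ≈ 0#
  IsProper⇒1≉0 {I} proper 1≈0 = proper (resp I (sym 1≈0) (0∈ I))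

  ⊤ᴵ-nonzero : ¬ 1# ≈ 0# → IsNonzero T ⊤ᴵ
  ⊤ᴵ-nonzero 1≉0 zero = 1≉0 (zero 1# (lift tt))

  0ᴵ-proper : ¬ 1# ≈ 0# → IsProper T 0ᴵ
  0ᴵ-proper 1≉0 (lift 1≈0) = 1≉0 1≈0

  IsOnlyNonzeroProperIdeal : Ideal T → Set (lsuc (c ⊔ ℓ))
  IsOnlyNonzeroProperIdeal M = ∀ I → IsNonzero T I → IsProper T I → I ≋ M

  IsMinimalNonzero : Ideal T → Set (lsuc (c ⊔ ℓ))
  IsMinimalNonzero M = ∀ I → IsNonzero T I → I ⊆ M → I ≋ M

  IsMaximal⇒1∈+ᴵ⟨⟩ : ∀ {M : Ideal T} {a : Carrier} → IsMaximal T M → ¬ mem M a → mem (M +ᴵ ⟨ a ⟩) 1#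
  IsMaximal⇒1∈+ᴵ⟨⟩ {M} {a} (_ , maximal) a∉M with maximal (M +ᴵ ⟨ a ⟩) (⊆-+ᴵˡ {M} {⟨ a ⟩})
  ... | inj₁ M+⟨a⟩≋M = ⊥-elim (a∉M (proj₁ (M+⟨a⟩≋M a) (⊆-+ᴵʳ {M} {⟨ a ⟩} a (a∈⟨a⟩ a))))
  ... | inj₂ 1∈M+⟨a⟩ = 1∈M+⟨a⟩

  -- With i + m = 1 and x ∉ ⟨ i ⟩ we get x m ≠ 0, so minimality forces ⟨ x m ⟩ = M ∋ m.
  complement-of-minimal⇒1∈ : ∀ {M J : Ideal T} {i m x : Carrier} → IsMinimalNonzero M → mem M m → i + m ≈ 1# →
                              ⟨ i ⟩ ⊆ J → mem J x → ¬ mem ⟨ i ⟩ x → mem J 1#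
  complement-of-minimal⇒1∈ {M} {J} {i} {m} {x} minimal m∈M i+m≈1 ⟨i⟩⊆J x∈J x∉⟨i⟩ =
    resp J i+m≈1 (+-closed J (⟨i⟩⊆J i (a∈⟨a⟩ i)) m∈J)
    where
    xm≉0 : ¬ x * m ≈ 0#
    xm≉0 xm≈0 = x∉⟨i⟩ (x , (begin
      x               ≈⟨ *-identityʳ x ⟨
      x * 1#          ≈⟨ *-cong refl i+m≈1 ⟨
      x * (i + m)     ≈⟨ distribˡ x i m ⟩
      x * i + x * m   ≈⟨ +-cong refl xm≈0 ⟩
      x * i + 0#      ≈⟨ +-identityʳ (x * i) ⟩
      x * i           ∎))
    m∈⟨xm⟩ : mem ⟨ x * m ⟩ m
    m∈⟨xm⟩ = proj₂ (minimal ⟨ x * m ⟩ (∈⇒IsNonzero {⟨ x * m ⟩} (a∈⟨a⟩ (x * m)) xm≉0)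
                      (⟨⟩-least {M} (*-closed M x m∈M)) m) m∈M
    m∈J : mem J m
    m∈J = ⟨⟩-least {J} (resp J (*-comm m x) (*-closed J m x∈J)) m m∈⟨xm⟩

module ClassicalIdealLemmas {c ℓ : Level} (em : ExcludedMiddle (lsuc (c ⊔ ℓ))) (T : CommutativeRing c ℓ) where
  open CommutativeRing T
  open IdealLemmas T

  open import Algebra.Properties.CommutativeSemigroup *-commutativeSemigroup using (x∙yz≈y∙xz)
  open import Relation.Binary.Reasoning.Setoid setoid

  dec : (A : Set (c ⊔ ℓ)) → Dec A
  dec A = map′ lower lift em

  dne : {A : Set (c ⊔ ℓ)} → ¬ ¬ A → A
  dne = decidable-stable (dec _)

  dne≈ : ∀ {x y} → ¬ ¬ x ≈ y → x ≈ y
  dne≈ = decidable-stable (map′ lower lift (dec (Lift c _)))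

  IsMaximal⇒IsPrime : ∀ {M : Ideal T} → IsMaximal T M → IsPrime T M
  IsMaximal⇒IsPrime {M} maxM = proj₁ maxM , prime
    where
    prime : ∀ a b → mem M (a * b) → mem M a ⊎ mem M b
    prime a b ab∈M with dec (mem M a)
    ... | yes a∈M = inj₁ a∈M
    ... | no a∉M with IsMaximal⇒1∈+ᴵ⟨⟩ {M} maxM a∉M
    ... | m , y , m∈M , (r , y≈ra) , 1≈m+y =
      inj₂ (resp M (sym b≈) (+-closed M (*-closed M b m∈M) (*-closed M r ab∈M)))
      where
      b≈ : b ≈ b * m + r * (a * b)
      b≈ = begin
        b                   ≈⟨ *-identityʳ b ⟨
        b * 1#              ≈⟨ *-cong refl 1≈m+y ⟩
        b * (m + y)         ≈⟨ distribˡ b m y ⟩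
        b * m + b * y       ≈⟨ +-cong refl (*-cong refl y≈ra) ⟩
        b * m + b * (r * a) ≈⟨ +-cong refl (x∙yz≈y∙xz b r a) ⟩
        b * m + r * (b * a) ≈⟨ +-cong refl (*-cong refl (*-comm b a)) ⟩
        b * m + r * (a * b) ∎

  IsField⇒ideal-dichotomy : IsField T → ∀ I → IsZero I ⊎ mem I 1#
  IsField⇒ideal-dichotomy (_ , inverse) I with dec (mem I 1#)
  ... | yes 1∈I = inj₂ 1∈I
  ... | no 1∉I = inj₁ λ x x∈I → dne≈ λ x≉0 → 1∉I (unit∈I x x∈I x≉0)
    where
    unit∈I : ∀ x → mem I x → ¬ x ≈ 0# → mem I 1#
    unit∈I x x∈I x≉0 with inverse x x≉0
    ... | y , xy≈1 = resp I (trans (*-comm y x) xy≈1) (*-closed I y x∈I)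

  IsField⇒IsPrime-0ᴵ : IsField T → IsPrime T 0ᴵ
  IsField⇒IsPrime-0ᴵ isField@(1≉0 , _) = IsMaximal⇒IsPrime {0ᴵ} (0ᴵ-proper 1≉0 , maximal)
    where
    maximal : ∀ J → 0ᴵ ⊆ J → J ≋ 0ᴵ ⊎ mem J 1#
    maximal J _ with IsField⇒ideal-dichotomy isField J
    ... | inj₁ zero = inj₁ (IsZero⇒≋ {J} {0ᴵ} zero λ _ → lower)
    ... | inj₂ 1∈J = inj₂ 1∈J

  IsMaximal∧¬IsField⇒IsNonzero : ∀ {M : Ideal T} → IsMaximal T M → ¬ IsField T → IsNonzero T M
  IsMaximal∧¬IsField⇒IsNonzero {M} (proper , maximal) ¬field zero =
    ¬field (IsProper⇒1≉0 {M} proper , inverse)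
    where
    inverse : ∀ x → ¬ x ≈ 0# → Σ Carrier λ y → x * y ≈ 1#
    inverse x x≉0 with maximal ⟨ x ⟩ (λ y y∈M → resp ⟨ x ⟩ (sym (zero y y∈M)) (0∈ ⟨ x ⟩))
    ... | inj₁ ⟨x⟩≋M = ⊥-elim (x≉0 (zero x (proj₁ (⟨x⟩≋M x) (a∈⟨a⟩ x))))
    ... | inj₂ (r , 1≈rx) = r , trans (*-comm x r) (sym 1≈rx)

  IsOnlyNonzeroProperIdeal⇒proper⊆ : ∀ {M I : Ideal T} → IsOnlyNonzeroProperIdeal M → IsProper T I → I ⊆ M
  IsOnlyNonzeroProperIdeal⇒proper⊆ {M} {I} only proper with dec (IsZero I)
  ... | yes zero = λ x x∈I → resp M (sym (zero x x∈I)) (0∈ M)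
  ... | no nonzero = λ x → proj₁ (only I nonzero proper x)

  -- Without Zorn's lemma, uniqueness of the maximal ideal M does not by itself put every
  -- proper ideal inside M; minimality of M is what makes the ideal ⟨ i ⟩ below maximal.
  unique-minimal⇒proper⊆ : ∀ {M I : Ideal T} → IsUniqueMaximal T M → IsMinimalNonzero M → IsProper T I → I ⊆ M
  unique-minimal⇒proper⊆ {M} {I} (maxM@(properM , _) , unique) minimal properI x x∈I =
    dne λ x∉M → absurd (IsMaximal⇒1∈+ᴵ⟨⟩ {M} maxM x∉M)
    where
    absurd : ¬ mem (M +ᴵ ⟨ x ⟩) 1#
    absurd (m , y , m∈M , (r , y≈rx) , 1≈m+y) = properM (resp M i+m≈1 (+-closed M i∈M m∈M))
      where
      i : Carrier
      i = r * x
      i+m≈1 : i + m ≈ 1#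
      i+m≈1 = trans (+-comm i m) (trans (+-cong refl (sym y≈rx)) (sym 1≈m+y))
      extend : ∀ J → ⟨ i ⟩ ⊆ J → J ≋ ⟨ i ⟩ ⊎ mem J 1#
      extend J ⟨i⟩⊆J with dec (mem J 1#)
      ... | yes 1∈J = inj₂ 1∈J
      ... | no 1∉J = inj₁ λ z → (λ z∈J → dne λ z∉⟨i⟩ →
                                   1∉J (complement-of-minimal⇒1∈ {M} {J} minimal m∈M i+m≈1 ⟨i⟩⊆J z∈J z∉⟨i⟩))
                              , ⟨i⟩⊆J z
      maximal⟨i⟩ : IsMaximal T ⟨ i ⟩
      maximal⟨i⟩ = (λ 1∈⟨i⟩ → properI (⟨⟩-least {I} (*-closed I r x∈I) 1# 1∈⟨i⟩)) , extend
      i∈M : mem M i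
      i∈M = proj₁ (unique ⟨ i ⟩ maximal⟨i⟩ i) (a∈⟨a⟩ i)

  unique-minimal⇒IsOnlyNonzeroProperIdeal : ∀ {M : Ideal T} → IsUniqueMaximal T M → IsMinimalNonzero M →
                                           IsOnlyNonzeroProperIdeal M
  unique-minimal⇒IsOnlyNonzeroProperIdeal {M} uniqueM minimal I nonzero proper =
    minimal I nonzero (unique-minimal⇒proper⊆ {M} {I} uniqueM minimal proper)

module SplitGraphProperties {v q e k : Level} {V : Set v} {_~_ : V → V → Set q} {E : V → V → Set e}
                            (split : IsSplitGraph V _~_ E k) where
  private
    A B : V → Set k
    A = proj₁ split
    B = proj₁ (proj₂ split)

    A⊎B : ∀ x → A x ⊎ B x
    A⊎B = proj₁ (proj₂ (proj₂ split))

    clique : ∀ x y → A x → A y → ¬ x ~ y → E x y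
    clique = proj₁ (proj₂ (proj₂ (proj₂ (proj₂ split))))

    independent : ∀ x y → B x → B y → ¬ E x y
    independent = proj₂ (proj₂ (proj₂ (proj₂ (proj₂ split))))

    nonadjacent⇒B : ∀ x y → ¬ x ~ y → ¬ E x y → B x ⊎ B y
    nonadjacent⇒B x y x≁y ¬xy with A⊎B x | A⊎B y
    ... | inj₂ Bx | _      = inj₁ Bx
    ... | inj₁ _  | inj₂ By = inj₂ By
    ... | inj₁ Ax | inj₁ Ay = ⊥-elim (¬xy (clique x y Ax Ay x≁y))

    adjacent⇒A : ∀ x y → E x y → A x ⊎ A y
    adjacent⇒A x y xy with A⊎B x | A⊎B y
    ... | inj₁ Ax | _      = inj₁ Ax
    ... | inj₂ _  | inj₁ Ay = inj₂ Ay
    ... | inj₂ Bx | inj₂ By = ⊥-elim (independent x y Bx By xy)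

  no-induced-C₄ : ∀ x y u v → ¬ x ~ y → ¬ E x y → ¬ u ~ v → ¬ E u v →
                  E x u → E x v → E y u → E y v → ⊥
  no-induced-C₄ x y u v x≁y ¬xy u≁v ¬uv xu xv yu yv
    with nonadjacent⇒B x y x≁y ¬xy | nonadjacent⇒B u v u≁v ¬uv
  ... | inj₁ Bx | inj₁ Bu = independent x u Bx Bu xu
  ... | inj₁ Bx | inj₂ Bv = independent x v Bx Bv xv
  ... | inj₂ By | inj₁ Bu = independent y u By Bu yu
  ... | inj₂ By | inj₂ Bv = independent y v By Bv yv

  no-induced-2K₂ : ∀ a b c d → E a b → E c d →
                   ¬ a ~ c → ¬ a ~ d → ¬ b ~ c → ¬ b ~ d →
                   ¬ E a c → ¬ E a d → ¬ E b c → ¬ E b d → ⊥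
  no-induced-2K₂ a b c d ab cd a≁c a≁d b≁c b≁d ¬ac ¬ad ¬bc ¬bd
    with adjacent⇒A a b ab | adjacent⇒A c d cd
  ... | inj₁ Aa | inj₁ Ac = ¬ac (clique a c Aa Ac a≁c)
  ... | inj₁ Aa | inj₂ Ad = ¬ad (clique a d Aa Ad a≁d)
  ... | inj₂ Ab | inj₁ Ac = ¬bc (clique b c Ab Ac b≁c)
  ... | inj₂ Ab | inj₂ Ad = ¬bd (clique b d Ab Ad b≁d)

module DirectProductIdeals {o ℓ : Level} (em : ExcludedMiddle (lsuc (o ⊔ ℓ)))
  (R P Q : CommutativeRing o ℓ)
  (f : CommutativeRing.Carrier R → CommutativeRing.Carrier P × CommutativeRing.Carrier Q)
  (iso : IsRingIsomorphism (CommutativeRing.rawRing R) (CommutativeRing.rawRing (P ⊗ Q)) f) where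
  private
    module P = CommutativeRing P
    module Q = CommutativeRing Q
    module Pᴵ = IdealLemmas P
    module Qᴵ = IdealLemmas Q
    module Pᶜ = ClassicalIdealLemmas em P
    module Qᶜ = ClassicalIdealLemmas em Q
  open CommutativeRing R
  open IdealLemmas R
  open ClassicalIdealLemmas em R using (dec)
  open IsRingIsomorphism iso using (⟦⟧-cong; +-homo; *-homo; -‿homo; 0#-homo; 1#-homo; injective; surjective)
  open RingProperties P.ring using () renaming (-0#≈0# to -0#≈0#ᴾ)
  open RingProperties Q.ring using () renaming (-0#≈0# to -0#≈0#ᴼ)

  π₁ : Carrier → P.Carrier
  π₁ x = proj₁ (f x)

  π₂ : Carrier → Q.Carrier
  π₂ x = proj₂ (f x)

  coords-injective : ∀ {x y} → π₁ x P.≈ π₁ y → π₂ x Q.≈ π₂ y → x ≈ y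
  coords-injective p q = injective (p , q)

  pair : P.Carrier → Q.Carrier → Carrier
  pair a b = proj₁ (surjective (a , b))

  π₁-pair : ∀ {a b} → π₁ (pair a b) P.≈ a
  π₁-pair {a} {b} = proj₁ (proj₂ (surjective (a , b)) refl)

  π₂-pair : ∀ {a b} → π₂ (pair a b) Q.≈ b
  π₂-pair {a} {b} = proj₂ (proj₂ (surjective (a , b)) refl)

  pair-cong : ∀ {a a′ b b′} → a P.≈ a′ → b Q.≈ b′ → pair a b ≈ pair a′ b′
  pair-cong a≈a′ b≈b′ = coords-injective (P.trans π₁-pair (P.trans a≈a′ (P.sym π₁-pair)))
                                         (Q.trans π₂-pair (Q.trans b≈b′ (Q.sym π₂-pair)))

  pair-0 : pair P.0# Q.0# ≈ 0#
  pair-0 = coords-injective (P.trans π₁-pair (P.sym (proj₁ 0#-homo)))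
                            (Q.trans π₂-pair (Q.sym (proj₂ 0#-homo)))

  pair-1 : pair P.1# Q.1# ≈ 1#
  pair-1 = coords-injective (P.trans π₁-pair (P.sym (proj₁ 1#-homo)))
                            (Q.trans π₂-pair (Q.sym (proj₂ 1#-homo)))

  pair-+ : ∀ {a a′ b b′} → pair a b + pair a′ b′ ≈ pair (a P.+ a′) (b Q.+ b′)
  pair-+ = coords-injective
    (P.trans (proj₁ (+-homo _ _)) (P.trans (P.+-cong π₁-pair π₁-pair) (P.sym π₁-pair)))
    (Q.trans (proj₂ (+-homo _ _)) (Q.trans (Q.+-cong π₂-pair π₂-pair) (Q.sym π₂-pair)))

  pair-neg : ∀ {a b} → - pair a b ≈ pair (P.- a) (Q.- b)
  pair-neg = coords-injective
    (P.trans (proj₁ (-‿homo _)) (P.trans (P.-‿cong π₁-pair) (P.sym π₁-pair)))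
    (Q.trans (proj₂ (-‿homo _)) (Q.trans (Q.-‿cong π₂-pair) (Q.sym π₂-pair)))

  pair-* : ∀ {a b} z → pair a b * z ≈ pair (a P.* π₁ z) (b Q.* π₂ z)
  pair-* z = coords-injective
    (P.trans (proj₁ (*-homo _ z)) (P.trans (P.*-cong π₁-pair P.refl) (P.sym π₁-pair)))
    (Q.trans (proj₂ (*-homo _ z)) (Q.trans (Q.*-cong π₂-pair Q.refl) (Q.sym π₂-pair)))

  pair-π : ∀ z → z ≈ pair (π₁ z) Q.0# + pair P.0# (π₂ z)
  pair-π z = coords-injective
    (P.sym (P.trans (proj₁ (+-homo _ _)) (P.trans (P.+-cong π₁-pair π₁-pair) (P.+-identityʳ _))))
    (Q.sym (Q.trans (proj₂ (+-homo _ _)) (Q.trans (Q.+-cong π₂-pair π₂-pair) (Q.+-identityˡ _))))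

  e₁ e₂ : Carrier
  e₁ = pair P.1# Q.0#
  e₂ = pair P.0# Q.1#

  e₁+e₂≈1 : e₁ + e₂ ≈ 1#
  e₁+e₂≈1 = trans pair-+ (trans (pair-cong (P.+-identityʳ _) (Q.+-identityˡ _)) pair-1)

  e₂+e₁≈1 : e₂ + e₁ ≈ 1#
  e₂+e₁≈1 = trans (+-comm e₂ e₁) e₁+e₂≈1

  e₁*e₂≈0 : e₁ * e₂ ≈ 0#
  e₁*e₂≈0 = trans (pair-* e₂) (trans (pair-cong (P.trans (P.*-identityˡ _) π₁-pair) (Q.zeroˡ _)) pair-0)

  ⟪_,_⟫ : Ideal P → Ideal Q → Ideal R
  ⟪ I , J ⟫ = record
    { mem = λ z → mem I (π₁ z) × mem J (π₂ z)
    ; resp = λ { x≈y (i , j) → resp I (proj₁ (⟦⟧-cong x≈y)) i , resp J (proj₂ (⟦⟧-cong x≈y)) j }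
    ; 0∈ = resp I (P.sym (proj₁ 0#-homo)) (0∈ I) , resp J (Q.sym (proj₂ 0#-homo)) (0∈ J)
    ; +-closed = λ { (i , j) (i′ , j′) → resp I (P.sym (proj₁ (+-homo _ _))) (+-closed I i i′)
                                       , resp J (Q.sym (proj₂ (+-homo _ _))) (+-closed J j j′) }
    ; neg-closed = λ { (i , j) → resp I (P.sym (proj₁ (-‿homo _))) (neg-closed I i)
                               , resp J (Q.sym (proj₂ (-‿homo _))) (neg-closed J j) }
    ; *-closed = λ { r (i , j) → resp I (P.sym (proj₁ (*-homo r _))) (*-closed I (π₁ r) i)
                               , resp J (Q.sym (proj₂ (*-homo r _))) (*-closed J (π₂ r) j) }
    }

  pair∈⟪⟫ : ∀ {I J a b} → mem I a → mem J b → mem ⟪ I , J ⟫ (pair a b)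
  pair∈⟪⟫ {I} {J} a∈I b∈J = resp I (P.sym π₁-pair) a∈I , resp J (Q.sym π₂-pair) b∈J

  pair∈⟪⟫⁻¹ : ∀ {I J a b} → mem ⟪ I , J ⟫ (pair a b) → mem I a × mem J b
  pair∈⟪⟫⁻¹ {I} {J} (i , j) = resp I π₁-pair i , resp J π₂-pair j

  ⟪⟫-mono : ∀ {I I′ J J′} → I Pᴵ.⊆ I′ → J Qᴵ.⊆ J′ → ⟪ I , J ⟫ ⊆ ⟪ I′ , J′ ⟫
  ⟪⟫-mono I⊆I′ J⊆J′ z (i , j) = I⊆I′ _ i , J⊆J′ _ j

  ⟪⟫-injˡ : ∀ {I I′ J} → ⟪ I , J ⟫ ≋ ⟪ I′ , J ⟫ → I Pᴵ.≋ I′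
  ⟪⟫-injˡ {I} {I′} {J} e a =
    (λ a∈I → proj₁ (pair∈⟪⟫⁻¹ {I′} {J} (proj₁ (e _) (pair∈⟪⟫ {I} {J} a∈I (0∈ J)))))
    , (λ a∈I′ → proj₁ (pair∈⟪⟫⁻¹ {I} {J} (proj₂ (e _) (pair∈⟪⟫ {I′} {J} a∈I′ (0∈ J)))))

  ⟪⟫-injʳ : ∀ {I J J′} → ⟪ I , J ⟫ ≋ ⟪ I , J′ ⟫ → J Qᴵ.≋ J′
  ⟪⟫-injʳ {I} {J} {J′} e b =
    (λ b∈J → proj₂ (pair∈⟪⟫⁻¹ {I} {J′} (proj₁ (e _) (pair∈⟪⟫ {I} {J} (0∈ I) b∈J))))
    , (λ b∈J′ → proj₂ (pair∈⟪⟫⁻¹ {I} {J} (proj₂ (e _) (pair∈⟪⟫ {I} {J′} (0∈ I) b∈J′))))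

  pair≈0 : ∀ {a b} → pair a b ≈ 0# → a P.≈ P.0# × b Q.≈ Q.0#
  pair≈0 p≈0 = P.trans (P.sym π₁-pair) (P.trans (proj₁ (⟦⟧-cong p≈0)) (proj₁ 0#-homo))
             , Q.trans (Q.sym π₂-pair) (Q.trans (proj₂ (⟦⟧-cong p≈0)) (proj₂ 0#-homo))

  ⟪⟫-nonzeroˡ : ∀ {I J} → IsNonzero P I → IsNonzero R ⟪ I , J ⟫
  ⟪⟫-nonzeroˡ {I} {J} nonzero zero =
    nonzero λ a a∈I → proj₁ (pair≈0 (zero _ (pair∈⟪⟫ {I} {J} a∈I (0∈ J))))

  ⟪⟫-nonzeroʳ : ∀ {I J} → IsNonzero Q J → IsNonzero R ⟪ I , J ⟫
  ⟪⟫-nonzeroʳ {I} {J} nonzero zero =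
    nonzero λ b b∈J → proj₂ (pair≈0 (zero _ (pair∈⟪⟫ {I} {J} (0∈ I) b∈J)))

  ⟪⟫-properˡ : ∀ {I J} → IsProper P I → IsProper R ⟪ I , J ⟫
  ⟪⟫-properˡ {I} proper (i , _) = proper (resp I (proj₁ 1#-homo) i)

  ⟪⟫-properʳ : ∀ {I J} → IsProper Q J → IsProper R ⟪ I , J ⟫
  ⟪⟫-properʳ {J = J} proper (_ , j) = proper (resp J (proj₂ 1#-homo) j)

  e₁∉⟪⟫ : ∀ {I J} → IsProper P I → ¬ mem ⟪ I , J ⟫ e₁
  e₁∉⟪⟫ {I} {J} proper e₁∈ = proper (proj₁ (pair∈⟪⟫⁻¹ {I} {J} e₁∈))

  e₂∉⟪⟫ : ∀ {I J} → IsProper Q J → ¬ mem ⟪ I , J ⟫ e₂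
  e₂∉⟪⟫ {I} {J} proper e₂∈ = proper (proj₂ (pair∈⟪⟫⁻¹ {I} {J} e₂∈))

  IsPrime-⟪⊤ᴵ,⟫ : ∀ {J} → IsPrime Q J → IsPrime R ⟪ Pᴵ.⊤ᴵ , J ⟫
  IsPrime-⟪⊤ᴵ,⟫ {J} (proper , prime) = (λ (_ , j) → proper (resp J (proj₂ 1#-homo) j)) , λ a b (_ , j) →
    ⊎-map (lift tt ,_) (lift tt ,_) (prime (π₂ a) (π₂ b) (resp J (proj₂ (*-homo a b)) j))

  IsPrime-⟪,⊤ᴵ⟫ : ∀ {I} → IsPrime P I → IsPrime R ⟪ I , Qᴵ.⊤ᴵ ⟫
  IsPrime-⟪,⊤ᴵ⟫ {I} (proper , prime) = (λ (i , _) → proper (resp I (proj₁ 1#-homo) i)) , λ a b (i , _) →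
    ⊎-map (_, lift tt) (_, lift tt) (prime (π₁ a) (π₁ b) (resp I (proj₁ (*-homo a b)) i))

  slice₁ : Ideal R → Ideal P
  slice₁ X = record
    { mem = λ a → mem X (pair a Q.0#)
    ; resp = λ a≈a′ → resp X (pair-cong a≈a′ Q.refl)
    ; 0∈ = resp X (sym pair-0) (0∈ X)
    ; +-closed = λ a∈ a′∈ → resp X (trans pair-+ (pair-cong P.refl (Q.+-identityʳ Q.0#))) (+-closed X a∈ a′∈)
    ; neg-closed = λ a∈ → resp X (trans pair-neg (pair-cong P.refl -0#≈0#ᴼ)) (neg-closed X a∈)
    ; *-closed = λ r a∈ → resp X (trans (pair-* _) (pair-cong (P.*-cong P.refl π₁-pair) (Q.zeroˡ _)))
                                 (*-closed X (pair r Q.0#) a∈)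
    }

  slice₂ : Ideal R → Ideal Q
  slice₂ X = record
    { mem = λ b → mem X (pair P.0# b)
    ; resp = λ b≈b′ → resp X (pair-cong P.refl b≈b′)
    ; 0∈ = resp X (sym pair-0) (0∈ X)
    ; +-closed = λ b∈ b′∈ → resp X (trans pair-+ (pair-cong (P.+-identityʳ P.0#) Q.refl)) (+-closed X b∈ b′∈)
    ; neg-closed = λ b∈ → resp X (trans pair-neg (pair-cong -0#≈0#ᴾ Q.refl)) (neg-closed X b∈)
    ; *-closed = λ r b∈ → resp X (trans (pair-* _) (pair-cong (P.zeroˡ _) (Q.*-cong Q.refl π₂-pair)))
                                 (*-closed X (pair P.0# r) b∈)
    }

  ∈⇒π₁∈slice₁ : ∀ {X z} → mem X z → mem (slice₁ X) (π₁ z)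
  ∈⇒π₁∈slice₁ {X} {z} z∈X =
    resp X (trans (pair-* z) (pair-cong (P.*-identityˡ _) (Q.zeroˡ _))) (*-closed X e₁ z∈X)

  ∈⇒π₂∈slice₂ : ∀ {X z} → mem X z → mem (slice₂ X) (π₂ z)
  ∈⇒π₂∈slice₂ {X} {z} z∈X =
    resp X (trans (pair-* z) (pair-cong (P.zeroˡ _) (Q.*-identityˡ _))) (*-closed X e₂ z∈X)

  ⊆⟪⟫ : ∀ {X I J} → slice₁ X Pᴵ.⊆ I → slice₂ X Qᴵ.⊆ J → X ⊆ ⟪ I , J ⟫
  ⊆⟪⟫ {X} s₁⊆I s₂⊆J z z∈X = s₁⊆I _ (∈⇒π₁∈slice₁ {X} z∈X) , s₂⊆J _ (∈⇒π₂∈slice₂ {X} z∈X)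

  ⟪⟫⊆ : ∀ {X I J} → I Pᴵ.⊆ slice₁ X → J Qᴵ.⊆ slice₂ X → ⟪ I , J ⟫ ⊆ X
  ⟪⟫⊆ {X} I⊆s₁ J⊆s₂ z (i , j) = resp X (sym (pair-π z)) (+-closed X (I⊆s₁ _ i) (J⊆s₂ _ j))

  ≋-from-slices : ∀ {X Y} → slice₁ X Pᴵ.≋ slice₁ Y → slice₂ X Qᴵ.≋ slice₂ Y → X ≋ Y
  ≋-from-slices {X} {Y} s₁≋ s₂≋ z =
    (λ z∈X → ⟪⟫⊆ {Y} {slice₁ Y} {slice₂ Y} (λ _ i → i) (λ _ j → j) z
               (⊆⟪⟫ {X} {slice₁ Y} {slice₂ Y} (λ _ → proj₁ (s₁≋ _)) (λ _ → proj₁ (s₂≋ _)) z z∈X))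
    , (λ z∈Y → ⟪⟫⊆ {X} {slice₁ X} {slice₂ X} (λ _ i → i) (λ _ j → j) z
               (⊆⟪⟫ {Y} {slice₁ X} {slice₂ X} (λ _ → proj₂ (s₁≋ _)) (λ _ → proj₂ (s₂≋ _)) z z∈Y))

  IsZero-from-slices : ∀ {X} → Pᴵ.IsZero (slice₁ X) → Qᴵ.IsZero (slice₂ X) → IsZero X
  IsZero-from-slices {X} zero₁ zero₂ z z∈X = coords-injective
    (P.trans (zero₁ _ (∈⇒π₁∈slice₁ {X} z∈X)) (P.sym (proj₁ 0#-homo)))
    (Q.trans (zero₂ _ (∈⇒π₂∈slice₂ {X} z∈X)) (Q.sym (proj₂ 0#-homo)))

  IsPrime⇒e₁∈⊎e₂∈ : ∀ {X} → IsPrime R X → mem X e₁ ⊎ mem X e₂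
  IsPrime⇒e₁∈⊎e₂∈ {X} (_ , prime) = prime e₁ e₂ (resp X (sym e₁*e₂≈0) (0∈ X))

  e₁∈⇒e₂∉ : ∀ {X} → IsProper R X → mem X e₁ → ¬ mem X e₂
  e₁∈⇒e₂∉ {X} proper e₁∈X e₂∈X = proper (resp X e₁+e₂≈1 (+-closed X e₁∈X e₂∈X))

  nonzero-maximals⇒¬split : ∀ {M₁ M₂} → IsMaximal P M₁ → IsNonzero P M₁ → IsMaximal Q M₂ → IsNonzero Q M₂ →
                            ¬ PIS-IsSplit R
  nonzero-maximals⇒¬split {M₁} {M₂} max₁@(proper₁ , _) nonzero₁ max₂@(proper₂ , _) nonzero₂ split =
    no-induced-2K₂ a b c d
      (⊆⇒PIS-Adj {a} {b} (⟪⟫-mono {Pᴵ.⊤ᴵ} {Pᴵ.⊤ᴵ} {Qᴵ.0ᴵ} {M₂} (λ _ i → i) (Qᴵ.0ᴵ-least {M₂})) (IsPrime-⟪⊤ᴵ,⟫ {M₂} (Qᶜ.IsMaximal⇒IsPrime {M₂} max₂))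
                 (λ A≋B → Qᴵ.IsNonzero⇒≉0ᴵ {M₂} nonzero₂ (⟪⟫-injʳ {Pᴵ.⊤ᴵ} {Qᴵ.0ᴵ} {M₂} A≋B)))
      (⊆⇒PIS-Adj {c} {d} (⟪⟫-mono {Pᴵ.0ᴵ} {M₁} {Qᴵ.⊤ᴵ} {Qᴵ.⊤ᴵ} (Pᴵ.0ᴵ-least {M₁}) (λ _ j → j)) (IsPrime-⟪,⊤ᴵ⟫ {M₁} (Pᶜ.IsMaximal⇒IsPrime {M₁} max₁))
                 (λ C≋D → Pᴵ.IsNonzero⇒≉0ᴵ {M₁} nonzero₁ (⟪⟫-injˡ {Pᴵ.0ᴵ} {M₁} {Qᴵ.⊤ᴵ} C≋D)))
      (∈∉⇒≉ {A} {C} e₁∈A e₁∉C) (∈∉⇒≉ {A} {D} e₁∈A e₁∉D) (∈∉⇒≉ {B} {C} e₁∈B e₁∉C) (∈∉⇒≉ {B} {D} e₁∈B e₁∉D)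
      (1≈+⇒¬PIS-Adj {a} {c} e₁∈A e₂∈C e₁+e₂≈1) (1≈+⇒¬PIS-Adj {a} {d} e₁∈A e₂∈D e₁+e₂≈1)
      (1≈+⇒¬PIS-Adj {b} {c} e₁∈B e₂∈C e₁+e₂≈1) (1≈+⇒¬PIS-Adj {b} {d} e₁∈B e₂∈D e₁+e₂≈1)
    where
    open SplitGraphProperties split
    1≉0ᴾ : ¬ P.1# P.≈ P.0#
    1≉0ᴾ = Pᴵ.IsProper⇒1≉0 {M₁} proper₁
    1≉0ᴼ : ¬ Q.1# Q.≈ Q.0#
    1≉0ᴼ = Qᴵ.IsProper⇒1≉0 {M₂} proper₂
    A B C D : Ideal R
    A = ⟪ Pᴵ.⊤ᴵ , Qᴵ.0ᴵ ⟫
    B = ⟪ Pᴵ.⊤ᴵ , M₂ ⟫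
    C = ⟪ Pᴵ.0ᴵ , Qᴵ.⊤ᴵ ⟫
    D = ⟪ M₁ , Qᴵ.⊤ᴵ ⟫
    a b c d : Vertex R
    a = A , ⟪⟫-nonzeroˡ {Pᴵ.⊤ᴵ} {Qᴵ.0ᴵ} (Pᴵ.⊤ᴵ-nonzero 1≉0ᴾ) , ⟪⟫-properʳ {Pᴵ.⊤ᴵ} {Qᴵ.0ᴵ} (Qᴵ.0ᴵ-proper 1≉0ᴼ)
    b = B , ⟪⟫-nonzeroˡ {Pᴵ.⊤ᴵ} {M₂} (Pᴵ.⊤ᴵ-nonzero 1≉0ᴾ) , ⟪⟫-properʳ {Pᴵ.⊤ᴵ} {M₂} proper₂
    c = C , ⟪⟫-nonzeroʳ {Pᴵ.0ᴵ} {Qᴵ.⊤ᴵ} (Qᴵ.⊤ᴵ-nonzero 1≉0ᴼ) , ⟪⟫-properˡ {Pᴵ.0ᴵ} {Qᴵ.⊤ᴵ} (Pᴵ.0ᴵ-proper 1≉0ᴾ)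
    d = D , ⟪⟫-nonzeroʳ {M₁} {Qᴵ.⊤ᴵ} (Qᴵ.⊤ᴵ-nonzero 1≉0ᴼ) , ⟪⟫-properˡ {M₁} {Qᴵ.⊤ᴵ} proper₁
    e₁∈A : mem A e₁
    e₁∈A = pair∈⟪⟫ {Pᴵ.⊤ᴵ} {Qᴵ.0ᴵ} (lift tt) (lift Q.refl)
    e₁∈B : mem B e₁
    e₁∈B = pair∈⟪⟫ {Pᴵ.⊤ᴵ} {M₂} (lift tt) (0∈ M₂)
    e₂∈C : mem C e₂
    e₂∈C = pair∈⟪⟫ {Pᴵ.0ᴵ} {Qᴵ.⊤ᴵ} (lift P.refl) (lift tt)
    e₂∈D : mem D e₂
    e₂∈D = pair∈⟪⟫ {M₁} {Qᴵ.⊤ᴵ} (0∈ M₁) (lift tt)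
    e₁∉C : ¬ mem C e₁
    e₁∉C = e₁∉⟪⟫ {Pᴵ.0ᴵ} {Qᴵ.⊤ᴵ} (Pᴵ.0ᴵ-proper 1≉0ᴾ)
    e₁∉D : ¬ mem D e₁
    e₁∉D = e₁∉⟪⟫ {M₁} {Qᴵ.⊤ᴵ} proper₁

  field-split⇒IsMinimalNonzero : ∀ {M} → IsField P → IsMaximal Q M → IsNonzero Q M → PIS-IsSplit R →
                                 Qᴵ.IsMinimalNonzero M
  field-split⇒IsMinimalNonzero {M} fieldP@(1≉0ᴾ , _) maxM@(properM , _) nonzeroM split X nonzeroX X⊆M =
    Qᶜ.dne λ X≉M → no-induced-C₄ x y u v
      (λ 0×X≋0×M → X≉M (⟪⟫-injʳ {Pᴵ.0ᴵ} {X} {M} 0×X≋0×M))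
      (λ (_ , prime) → [ e₁∉⟪⟫ {Pᴵ.0ᴵ} {M} 0ᴾ-proper ∘ 0×X+0×M⊆0×M e₁
                       , e₂∉⟪⟫ {Pᴵ.0ᴵ} {M} properM ∘ 0×X+0×M⊆0×M e₂ ]′
                       (IsPrime⇒e₁∈⊎e₂∈ {0×X +ᴵ 0×M} prime))
      (∉∈⇒≉ {0×Q} {P×M} (e₁∉⟪⟫ {Pᴵ.0ᴵ} {Qᴵ.⊤ᴵ} 0ᴾ-proper) e₁∈P×M)
      (1≈+⇒¬PIS-Adj {u} {v} e₂∈0×Q e₁∈P×M e₂+e₁≈1)
      (⊆⇒PIS-Adj {x} {u} (⟪⟫-mono {Pᴵ.0ᴵ} {Pᴵ.0ᴵ} {X} {Qᴵ.⊤ᴵ} (λ _ i → i) (Qᴵ.⊆-⊤ᴵ {X})) 0×Q-prime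
                 (∉∈⇒≉ {0×X} {0×Q} (e₂∉⟪⟫ {Pᴵ.0ᴵ} {X} X-proper) e₂∈0×Q))
      (⊆⇒PIS-Adj {x} {v} (⟪⟫-mono {Pᴵ.0ᴵ} {Pᴵ.⊤ᴵ} {X} {M} (Pᴵ.⊆-⊤ᴵ {Pᴵ.0ᴵ}) X⊆M) P×M-prime
                 (∉∈⇒≉ {0×X} {P×M} (e₁∉⟪⟫ {Pᴵ.0ᴵ} {X} 0ᴾ-proper) e₁∈P×M))
      (⊆⇒PIS-Adj {y} {u} (⟪⟫-mono {Pᴵ.0ᴵ} {Pᴵ.0ᴵ} {M} {Qᴵ.⊤ᴵ} (λ _ i → i) (Qᴵ.⊆-⊤ᴵ {M})) 0×Q-prime
                 (∉∈⇒≉ {0×M} {0×Q} (e₂∉⟪⟫ {Pᴵ.0ᴵ} {M} properM) e₂∈0×Q))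
      (⊆⇒PIS-Adj {y} {v} (⟪⟫-mono {Pᴵ.0ᴵ} {Pᴵ.⊤ᴵ} {M} {M} (Pᴵ.⊆-⊤ᴵ {Pᴵ.0ᴵ}) (λ _ i → i)) P×M-prime
                 (∉∈⇒≉ {0×M} {P×M} (e₁∉⟪⟫ {Pᴵ.0ᴵ} {M} 0ᴾ-proper) e₁∈P×M))
    where
    open SplitGraphProperties split
    0ᴾ-proper : IsProper P Pᴵ.0ᴵ
    0ᴾ-proper = Pᴵ.0ᴵ-proper 1≉0ᴾ
    X-proper : IsProper Q X
    X-proper 1∈X = properM (X⊆M _ 1∈X)
    0×X 0×M 0×Q P×M : Ideal R
    0×X = ⟪ Pᴵ.0ᴵ , X ⟫
    0×M = ⟪ Pᴵ.0ᴵ , M ⟫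
    0×Q = ⟪ Pᴵ.0ᴵ , Qᴵ.⊤ᴵ ⟫
    P×M = ⟪ Pᴵ.⊤ᴵ , M ⟫
    x y u v : Vertex R
    x = 0×X , ⟪⟫-nonzeroʳ {Pᴵ.0ᴵ} {X} nonzeroX , ⟪⟫-properʳ {Pᴵ.0ᴵ} {X} X-proper
    y = 0×M , ⟪⟫-nonzeroʳ {Pᴵ.0ᴵ} {M} nonzeroM , ⟪⟫-properʳ {Pᴵ.0ᴵ} {M} properM
    u = 0×Q , ⟪⟫-nonzeroʳ {Pᴵ.0ᴵ} {Qᴵ.⊤ᴵ} (Qᴵ.⊤ᴵ-nonzero (Qᴵ.IsProper⇒1≉0 {M} properM))
            , ⟪⟫-properˡ {Pᴵ.0ᴵ} {Qᴵ.⊤ᴵ} 0ᴾ-proper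
    v = P×M , ⟪⟫-nonzeroˡ {Pᴵ.⊤ᴵ} {M} (Pᴵ.⊤ᴵ-nonzero 1≉0ᴾ) , ⟪⟫-properʳ {Pᴵ.⊤ᴵ} {M} properM
    0×X+0×M⊆0×M : 0×X +ᴵ 0×M ⊆ 0×M
    0×X+0×M⊆0×M = +ᴵ-least {0×X} {0×M} {0×M} (⟪⟫-mono {Pᴵ.0ᴵ} {Pᴵ.0ᴵ} {X} {M} (λ _ i → i) X⊆M) (λ _ i → i)
    e₂∈0×Q : mem 0×Q e₂
    e₂∈0×Q = pair∈⟪⟫ {Pᴵ.0ᴵ} {Qᴵ.⊤ᴵ} (lift P.refl) (lift tt)
    e₁∈P×M : mem P×M e₁
    e₁∈P×M = pair∈⟪⟫ {Pᴵ.⊤ᴵ} {M} (lift tt) (0∈ M)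
    0×Q-prime : IsPrime R 0×Q
    0×Q-prime = IsPrime-⟪,⊤ᴵ⟫ {Pᴵ.0ᴵ} (Pᶜ.IsField⇒IsPrime-0ᴵ fieldP)
    P×M-prime : IsPrime R P×M
    P×M-prime = IsPrime-⟪⊤ᴵ,⟫ {M} (Qᶜ.IsMaximal⇒IsPrime {M} maxM)

  fields⇒split : IsField P → IsField Q → PIS-IsSplit R
  fields⇒split fieldP fieldQ =
    (λ _ → Lift (o ⊔ ℓ) ⊥) , (λ _ → Lift (o ⊔ ℓ) ⊤) , (λ _ → inj₂ (lift tt)) , (λ _ ()) ,
    (λ _ _ ()) , (λ x y _ _ → independent x y)
    where
    classify : ∀ X → IsNonzero R X → IsProper R X →
               (mem X e₁ × Qᴵ.IsZero (slice₂ X)) ⊎ (Pᴵ.IsZero (slice₁ X) × mem X e₂)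
    classify X nonzero proper
      with Pᶜ.IsField⇒ideal-dichotomy fieldP (slice₁ X) | Qᶜ.IsField⇒ideal-dichotomy fieldQ (slice₂ X)
    ... | inj₂ e₁∈X  | inj₂ e₂∈X  = ⊥-elim (e₁∈⇒e₂∉ {X} proper e₁∈X e₂∈X)
    ... | inj₂ e₁∈X  | inj₁ zero₂ = inj₁ (e₁∈X , zero₂)
    ... | inj₁ zero₁ | inj₂ e₂∈X  = inj₂ (zero₁ , e₂∈X)
    ... | inj₁ zero₁ | inj₁ zero₂ = ⊥-elim (nonzero (IsZero-from-slices {X} zero₁ zero₂))

    independent : ∀ x y → ¬ PIS-Adj R x y
    independent x@(X , nonzeroX , properX) y@(Y , nonzeroY , properY) adj@(X≉Y , _)
      with classify X nonzeroX properX | classify Y nonzeroY properY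
    ... | inj₁ (e₁∈X , zero₂X) | inj₁ (e₁∈Y , zero₂Y) =
      X≉Y (≋-from-slices {X} {Y} (Pᴵ.1∈⇒≋ {slice₁ X} {slice₁ Y} e₁∈X e₁∈Y)
                                 (Qᴵ.IsZero⇒≋ {slice₂ X} {slice₂ Y} zero₂X zero₂Y))
    ... | inj₁ (e₁∈X , _) | inj₂ (_ , e₂∈Y) = 1≈+⇒¬PIS-Adj {x} {y} e₁∈X e₂∈Y e₁+e₂≈1 adj
    ... | inj₂ (_ , e₂∈X) | inj₁ (e₁∈Y , _) = 1≈+⇒¬PIS-Adj {x} {y} e₂∈X e₁∈Y e₂+e₁≈1 adj
    ... | inj₂ (zero₁X , e₂∈X) | inj₂ (zero₁Y , e₂∈Y) =
      X≉Y (≋-from-slices {X} {Y} (Pᴵ.IsZero⇒≋ {slice₁ X} {slice₁ Y} zero₁X zero₁Y)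
                                 (Qᴵ.1∈⇒≋ {slice₂ X} {slice₂ Y} e₂∈X e₂∈Y))

  field×local⇒split : ∀ {M} → IsField P → IsMaximal Q M → Qᴵ.IsOnlyNonzeroProperIdeal M → PIS-IsSplit R
  field×local⇒split {M} fieldP maxM only =
    (λ x → ¬ mem (proj₁ x) e₂) , (λ x → mem (proj₁ x) e₂) , (λ x → ⊎-swap (toSum (dec _))) ,
    (λ _ e₂∉ e₂∈ → e₂∉ e₂∈) , clique , independent
    where
    dichotomy₁ : ∀ Z → Pᴵ.IsZero (slice₁ Z) ⊎ mem Z e₁
    dichotomy₁ = λ Z → Pᶜ.IsField⇒ideal-dichotomy fieldP (slice₁ Z)

    independent : ∀ x y → mem (proj₁ x) e₂ → mem (proj₁ y) e₂ → ¬ PIS-Adj R x y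
    independent (X , _ , properX) (Y , _ , properY) e₂∈X e₂∈Y (X≉Y , _) =
      X≉Y (≋-from-slices {X} {Y} (Pᴵ.IsZero⇒≋ {slice₁ X} {slice₁ Y} (zero₁ {X} properX e₂∈X) (zero₁ {Y} properY e₂∈Y))
                                 (Qᴵ.1∈⇒≋ {slice₂ X} {slice₂ Y} e₂∈X e₂∈Y))
      where
      zero₁ : ∀ {Z} → IsProper R Z → mem Z e₂ → Pᴵ.IsZero (slice₁ Z)
      zero₁ {Z} proper e₂∈Z with dichotomy₁ Z
      ... | inj₁ zero = zero
      ... | inj₂ e₁∈Z = ⊥-elim (e₁∈⇒e₂∉ {Z} proper e₁∈Z e₂∈Z)

    clique : ∀ x y → ¬ mem (proj₁ x) e₂ → ¬ mem (proj₁ y) e₂ → ¬ proj₁ x ≋ proj₁ y → PIS-Adj R x y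
    clique (X , nonzeroX , _) (Y , nonzeroY , _) e₂∉X e₂∉Y X≉Y =
      X≉Y , IsPrime-resp {P×M} {X +ᴵ Y} P×M≋X+Y (IsPrime-⟪⊤ᴵ,⟫ {M} (Qᶜ.IsMaximal⇒IsPrime {M} maxM))
      where
      P×M : Ideal R
      P×M = ⟪ Pᴵ.⊤ᴵ , M ⟫

      below-P×M : ∀ {Z} → ¬ mem Z e₂ → Z ⊆ P×M
      below-P×M {Z} e₂∉Z = ⊆⟪⟫ {Z} {Pᴵ.⊤ᴵ} {M} (Pᴵ.⊆-⊤ᴵ {slice₁ Z})
                                   (Qᶜ.IsOnlyNonzeroProperIdeal⇒proper⊆ {M} {slice₂ Z} only e₂∉Z)

      slice₂≋M : ∀ {Z} → IsNonzero R Z → ¬ mem Z e₂ → Pᴵ.IsZero (slice₁ Z) → slice₂ Z Qᴵ.≋ M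
      slice₂≋M {Z} nonzero e₂∉Z zero₁ =
        only (slice₂ Z) (λ zero₂ → nonzero (IsZero-from-slices {Z} zero₁ zero₂)) e₂∉Z

      e₁∈ : ∀ {Z} → IsNonzero R Z → Qᴵ.IsZero (slice₂ Z) → mem Z e₁
      e₁∈ {Z} nonzero zero₂ with dichotomy₁ Z
      ... | inj₁ zero₁ = ⊥-elim (nonzero (IsZero-from-slices {Z} zero₁ zero₂))
      ... | inj₂ e₁∈Z = e₁∈Z

      e₁∈X+Y : mem (X +ᴵ Y) e₁
      e₁∈X+Y with dichotomy₁ X | dichotomy₁ Y
      ... | inj₂ e₁∈X | _         = ⊆-+ᴵˡ {X} {Y} e₁ e₁∈X
      ... | inj₁ _    | inj₂ e₁∈Y = ⊆-+ᴵʳ {X} {Y} e₁ e₁∈Y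
      ... | inj₁ zero₁X | inj₁ zero₁Y =
        ⊥-elim (X≉Y (≋-from-slices {X} {Y} (Pᴵ.IsZero⇒≋ {slice₁ X} {slice₁ Y} zero₁X zero₁Y)
                                          (Qᴵ.≋-trans {slice₂ X} {M} {slice₂ Y} (slice₂≋M {X} nonzeroX e₂∉X zero₁X)
                                             (Qᴵ.≋-sym {slice₂ Y} {M} (slice₂≋M {Y} nonzeroY e₂∉Y zero₁Y)))))

      M⊆slice₂ : M Qᴵ.⊆ slice₂ (X +ᴵ Y)
      M⊆slice₂ with dec (Qᴵ.IsZero (slice₂ X)) | dec (Qᴵ.IsZero (slice₂ Y))
      ... | no nonzero₂X | _ = λ b b∈M → ⊆-+ᴵˡ {X} {Y} _ (proj₂ (only (slice₂ X) nonzero₂X e₂∉X b) b∈M)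
      ... | yes _ | no nonzero₂Y = λ b b∈M → ⊆-+ᴵʳ {X} {Y} _ (proj₂ (only (slice₂ Y) nonzero₂Y e₂∉Y b) b∈M)
      ... | yes zero₂X | yes zero₂Y =
        ⊥-elim (X≉Y (≋-from-slices {X} {Y} (Pᴵ.1∈⇒≋ {slice₁ X} {slice₁ Y} (e₁∈ {X} nonzeroX zero₂X) (e₁∈ {Y} nonzeroY zero₂Y))
                                          (Qᴵ.IsZero⇒≋ {slice₂ X} {slice₂ Y} zero₂X zero₂Y)))

      P×M≋X+Y : P×M ≋ X +ᴵ Y
      P×M≋X+Y z = ⟪⟫⊆ {X +ᴵ Y} {Pᴵ.⊤ᴵ} {M} (λ a _ → Pᴵ.1∈⇒∈ {slice₁ (X +ᴵ Y)} e₁∈X+Y a) M⊆slice₂ z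
                , +ᴵ-least {X} {Y} {P×M} (below-P×M {X} e₂∉X) (below-P×M {Y} e₂∉Y) z

swap-isRingIsomorphism : ∀ {c ℓ} (P Q : CommutativeRing c ℓ) →
  IsRingIsomorphism (CommutativeRing.rawRing (P ⊗ Q)) (CommutativeRing.rawRing (Q ⊗ P)) swap
swap-isRingIsomorphism P Q = record
  { isRingMonomorphism = record
    { isRingHomomorphism = record
      { isSemiringHomomorphism = record
        { isNearSemiringHomomorphism = record
          { +-isMonoidHomomorphism = record
            { isMagmaHomomorphism = record
              { isRelHomomorphism = record { cong = swap }
              ; homo = λ _ _ → Q.refl , P.refl }
            ; ε-homo = Q.refl , P.refl }
          ; *-homo = λ _ _ → Q.refl , P.refl }
        ; 1#-homo = Q.refl , P.refl }
      ; -‿homo = λ _ → Q.refl , P.refl }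
    ; injective = swap }
  ; surjective = λ (b , a) → (a , b) , swap }
  where
  module P = CommutativeRing P
  module Q = CommutativeRing Q

IsProductOfFields : ∀ {c ℓ} → CommutativeRing c ℓ → Set (lsuc (c ⊔ ℓ))
IsProductOfFields {c} {ℓ} R =
  Σ (CommutativeRing c ℓ) λ F₁ → Σ (CommutativeRing c ℓ) λ F₂ → IsField F₁ × IsField F₂ × R ≅ (F₁ ⊗ F₂)

IsFieldTimesLocalWithOneNonzeroProperIdeal : ∀ {c ℓ} → CommutativeRing c ℓ → Set (lsuc (c ⊔ ℓ))
IsFieldTimesLocalWithOneNonzeroProperIdeal {c} {ℓ} R =
  Σ (CommutativeRing c ℓ) λ F₁ → Σ (CommutativeRing c ℓ) λ S → Σ (Ideal S) λ M →
    IsField F₁ × IsUniqueMaximal S M × IsNonzero S M × IdealLemmas.IsOnlyNonzeroProperIdeal S M × R ≅ (F₁ ⊗ S)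

≅-⊗-comm : ∀ {c ℓ} {R P Q : CommutativeRing c ℓ} → R ≅ (P ⊗ Q) → R ≅ (Q ⊗ P)
≅-⊗-comm {P = P} {Q} (f , iso) =
  swap ∘ f , Composition.isRingIsomorphism (CommutativeRing.trans (Q ⊗ P)) iso (swap-isRingIsomorphism P Q)

field×nonfield-split⇒IsFieldTimesLocal : ∀ {c ℓ} → ExcludedMiddle (lsuc (c ⊔ ℓ)) → (R P Q : CommutativeRing c ℓ) →
  ∀ {M} → R ≅ (P ⊗ Q) → IsField P → ¬ IsField Q → IsUniqueMaximal Q M → PIS-IsSplit R →
  IsFieldTimesLocalWithOneNonzeroProperIdeal R
field×nonfield-split⇒IsFieldTimesLocal em R P Q {M} (f , iso) fieldP ¬fieldQ uniqueM@(maxM , _) split =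
  P , Q , M , fieldP , uniqueM , nonzeroM , only , f , iso
  where
  nonzeroM : IsNonzero Q M
  nonzeroM = ClassicalIdealLemmas.IsMaximal∧¬IsField⇒IsNonzero em Q {M} maxM ¬fieldQ
  only : IdealLemmas.IsOnlyNonzeroProperIdeal Q M
  only = ClassicalIdealLemmas.unique-minimal⇒IsOnlyNonzeroProperIdeal em Q {M} uniqueM
           (DirectProductIdeals.field-split⇒IsMinimalNonzero em R P Q f iso {M} fieldP maxM nonzeroM split)

split⇒classification : ∀ {c ℓ} → ExcludedMiddle (lsuc (c ⊔ ℓ)) → (R R₁ R₂ : CommutativeRing c ℓ) →
  ∀ {M₁ M₂} → IsUniqueMaximal R₁ M₁ → IsUniqueMaximal R₂ M₂ → R ≅ (R₁ ⊗ R₂) → PIS-IsSplit R →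
  IsProductOfFields R ⊎ IsFieldTimesLocalWithOneNonzeroProperIdeal R
split⇒classification em R R₁ R₂ {M₁} {M₂} unique₁ unique₂ R≅R₁⊗R₂@(f , iso) split
  with ClassicalIdealLemmas.dec em R₁ (IsField R₁) | ClassicalIdealLemmas.dec em R₂ (IsField R₂)
... | yes field₁ | yes field₂ = inj₁ (R₁ , R₂ , field₁ , field₂ , R≅R₁⊗R₂)
... | yes field₁ | no ¬field₂ =
  inj₂ (field×nonfield-split⇒IsFieldTimesLocal em R R₁ R₂ {M₂} R≅R₁⊗R₂ field₁ ¬field₂ unique₂ split)
... | no ¬field₁ | yes field₂ =
  inj₂ (field×nonfield-split⇒IsFieldTimesLocal em R R₂ R₁ {M₁} (≅-⊗-comm {R = R} {R₁} {R₂} R≅R₁⊗R₂) field₂ ¬field₁ unique₁ split)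
... | no ¬field₁ | no ¬field₂ = ⊥-elim
  (DirectProductIdeals.nonzero-maximals⇒¬split em R R₁ R₂ f iso {M₁} {M₂}
    (proj₁ unique₁) (ClassicalIdealLemmas.IsMaximal∧¬IsField⇒IsNonzero em R₁ {M₁} (proj₁ unique₁) ¬field₁)
    (proj₁ unique₂) (ClassicalIdealLemmas.IsMaximal∧¬IsField⇒IsNonzero em R₂ {M₂} (proj₁ unique₂) ¬field₂)
    split)

classification⇒split : ∀ {c ℓ} → ExcludedMiddle (lsuc (c ⊔ ℓ)) → (R : CommutativeRing c ℓ) →
  IsProductOfFields R ⊎ IsFieldTimesLocalWithOneNonzeroProperIdeal R → PIS-IsSplit R
classification⇒split em R (inj₁ (F₁ , F₂ , field₁ , field₂ , f , iso)) =
  DirectProductIdeals.fields⇒split em R F₁ F₂ f iso field₁ field₂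
classification⇒split em R (inj₂ (F₁ , S , M , field₁ , (maxM , _) , _ , only , f , iso)) =
  DirectProductIdeals.field×local⇒split em R F₁ S f iso {M} field₁ maxM only

mainTheorem2 : ∀ {c ℓ : Level} → ExcludedMiddle (lsuc (c ⊔ ℓ)) →
    (R R₁ R₂ : CommutativeRing c ℓ) (M₁ : Ideal R₁) (M₂ : Ideal R₂) →
    IsUniqueMaximal R₁ M₁ → IsUniqueMaximal R₂ M₂ →
    R ≅ (R₁ ⊗ R₂) →
    PIS-IsSplit R ⇔
      ((Σ (CommutativeRing c ℓ) λ F₁ → Σ (CommutativeRing c ℓ) λ F₂ →
          IsField F₁ × IsField F₂ × R ≅ (F₁ ⊗ F₂))
       ⊎
       (Σ (CommutativeRing c ℓ) λ F₁ → Σ (CommutativeRing c ℓ) λ S → Σ (Ideal S) λ M →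
          IsField F₁ × IsUniqueMaximal S M × IsNonzero S M ×
          (∀ I → IsNonzero S I → IsProper S I → _≐_ S I M) ×
          R ≅ (F₁ ⊗ S)))
mainTheorem2 em R R₁ R₂ M₁ M₂ unique₁ unique₂ R≅R₁⊗R₂ =
  mk⇔ (split⇒classification em R R₁ R₂ {M₁} {M₂} unique₁ unique₂ R≅R₁⊗R₂) (classification⇒split em R)
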